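{- Let $\pi\in\tilde{\mathcal{D}}^2_{2n}$. The graph $\Gamma(\pi)$ produced by the procedure described in the context does not depend on the choice of the valid total order $\le$ of $\binom{[n]}{2}$ used in the procedure.
   Context: $[n]=\{1,\dots,n\}$; $\mathcal{S}_{2n}$ is the symmetric group on $[2n]$, with product meaning composition, $(\sigma\rho)(x)=\sigma(\rho(x))$; $(a,b)$ denotes a transposition. $\tilde{\mathcal{D}}^2_{2n}$ is the set of $\pi\in\mathcal{S}_{2n}$ with $\pi(2i-1)\ge 2i-1$ and $\pi(2i)<2i$ for all $i\in[n]$, and $\pi(2i-1)>2i-1$ for all $i\in[n-1]$. On $\binom{[n]}{2}$ define $\preceq$ by: for $a<b$, $c<d$, $\{a,b\}\preceq\{c,d\}$ iff $c\le a<b\le d$; a valid order is a total order $\le$ on $\binom{[n]}{2}$ with $e\preceq e'\Rightarrow e\le e'$. For a permutation $\sigma$ and integers $2\le i<j\le 2n-1$ with $i$ even and $j$ odd, $i$ and $j$ are in edge configuration in $\sigma$ if ($\sigma^{ -1}(i)<\sigma^{ -1}(j)$ iff $\sigma^{ -1}(i)\equiv\sigma^{ -1}(j)\pmod 2$); otherwise they are in non-edge configuration. The map $\Gamma$: given $\pi$, start with $\sigma:=\pi$ and the edgeless graph on $[n]$; iterate over all pairs $\{u,v\}\in\binom{[n]}{2}$, $u<v$, in increasing order with respect to a valid order $\le$; if $2u$ and $2v-1$ are in edge configuration in the current $\sigma$, insert the edge $\{u,v\}$ and replace $\sigma$ by $(2u,2v-1)\sigma$. The resulting graph is $\Gamma(\pi)$.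 -}

module Defs where

open import Data.Nat using (ℕ; zero; suc; _+_; _*_; _≤_; _<_; _<ᵇ_; _%_)
open import Data.Nat.Properties using (_≟_)
open import Data.Bool using (Bool; true; false; if_then_else_; _∧_; _∨_)
open import Data.Bool.Properties using () renaming (_≟_ to _≟ᵇ_)
open import Data.Fin using (Fin; toℕ; combine; zero; suc)
open import Data.Fin.Permutation using (Permutation′; _⟨$⟩ʳ_; _⟨$⟩ˡ_; _∘ₚ_; transpose)
open import Data.List using (List; []; _∷_; _++_; foldl)
open import Data.List.Membership.Propositional using (_∈_)
open import Data.List.Relation.Unary.Unique.Propositional using (Unique)
open import Data.List.Relation.Unary.All using (All)
open import Data.Product using (_×_; _,_; ∃-syntax; proj₁; proj₂)
open import Relation.Nullary.Decidable using (⌊_⌋)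
open import Relation.Binary.PropositionalEquality using (_≡_)

-- Convention: the set [m] = {1,…,m} is represented by Fin m, where the
-- element x : Fin m stands for the integer  lab x = toℕ x + 1.
lab : {m : ℕ} → Fin m → ℕ
lab x = suc (toℕ x)

Perm : ℕ → Set
Perm n = Permutation′ (n * 2)

-- For i : Fin n (standing for i ∈ [n]):
--   odd′  i  stands for 2i-1,   even′ i  stands for 2i   (elements of [2n]).
odd′ : {n : ℕ} → Fin n → Fin (n * 2)
odd′ i = combine i zero

even′ : {n : ℕ} → Fin n → Fin (n * 2)
even′ i = combine i (suc zero)

InD : (n : ℕ) → Perm n → Set
InD n π =
  ((i : Fin n) → lab (odd′ i) ≤ lab (π ⟨$⟩ʳ odd′ i)) ×
  ((i : Fin n) → lab (π ⟨$⟩ʳ even′ i) < lab (even′ i)) ×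
  ((i : Fin n) → lab i < n → lab (odd′ i) < lab (π ⟨$⟩ʳ odd′ i))

-- Pairs {a,b} ∈ binom([n],2) are represented as ordered pairs (a , b) with a < b.
Pair : ℕ → Set
Pair n = Fin n × Fin n

IsPair : {n : ℕ} → Pair n → Set
IsPair (a , b) = lab a < lab b

_⪯_ : {n : ℕ} → Pair n → Pair n → Set
(a , b) ⪯ (c , d) = lab c ≤ lab a × lab b ≤ lab d

-- A total order on the finite set binom([n],2) is represented by the list of
-- its elements in increasing order: e ≤_L e'  iff  e occurs in L no later than e'.
_≤[_]_ : {n : ℕ} → Pair n → List (Pair n) → Pair n → Set
e ≤[ L ] e' = ∃[ xs ] ∃[ ys ] (L ≡ xs ++ (e ∷ ys) × e' ∈ (e ∷ ys))

ValidOrder : (n : ℕ) → List (Pair n) → Set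
ValidOrder n L =
  All IsPair L ×
  Unique L ×
  ((e : Pair n) → IsPair e → e ∈ L) ×
  ((e e' : Pair n) → IsPair e → IsPair e' → e ⪯ e' → e ≤[ L ] e')

-- Edge configuration of (the elements standing for) i and j in σ:
--   σ⁻¹(i) < σ⁻¹(j)  iff  σ⁻¹(i) ≡ σ⁻¹(j) (mod 2).
edgeConfig : {m : ℕ} → Permutation′ m → Fin m → Fin m → Bool
edgeConfig σ i j =
  ⌊ (lab p <ᵇ lab q) ≟ᵇ ⌊ (lab p % 2) ≟ (lab q % 2) ⌋ ⌋
  where
    p = σ ⟨$⟩ˡ i
    q = σ ⟨$⟩ˡ j

Graph : ℕ → Set
Graph n = Fin n → Fin n → Bool

edgeless : {n : ℕ} → Graph n
edgeless _ _ = false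

finEq : {n : ℕ} → Fin n → Fin n → Bool
finEq x y = ⌊ toℕ x ≟ toℕ y ⌋

addEdge : {n : ℕ} → Graph n → Fin n → Fin n → Graph n
addEdge g u v x y = (finEq x u ∧ finEq y v) ∨ (finEq x v ∧ finEq y u) ∨ g x y

-- One step of the procedure, for the pair {u,v}:
-- if 2u and 2v-1 are in edge configuration in σ, insert {u,v} and
-- replace σ by (2u, 2v-1) σ, i.e. x ↦ (2u,2v-1)(σ(x)).
-- (In the stdlib, (σ ∘ₚ τ) ⟨$⟩ʳ x = τ ⟨$⟩ʳ (σ ⟨$⟩ʳ x).)
step : {n : ℕ} → Perm n × Graph n → Pair n → Perm n × Graph n
step (σ , g) (u , v) =
  if edgeConfig σ (even′ u) (odd′ v)
  then (σ ∘ₚ transpose (even′ u) (odd′ v) , addEdge g u v)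
  else (σ , g)

Γ : {n : ℕ} → List (Pair n) → Perm n → Graph n
Γ L π = proj₂ (foldl step (π , edgeless) L)

module Submission where

-- The step for the pair {u,v} reads σ only through σ⁻¹(2u) and σ⁻¹(2v-1), and it
-- changes σ⁻¹ only at 2u and 2v-1. Hence the steps for {u,v} and {u',v'} commute
-- as soon as u ≠ u' and v ≠ v'. Two pairs sharing their smaller or their larger
-- endpoint are comparable for ⪯, so the steps that do not commute are applied in
-- the same relative order by every valid order. Any two linear extensions of ⪯ are
-- therefore related by swaps of commuting steps: bubble the first pair of one order
-- to the front of the other past incomparable pairs, and recurse.

open import Defs
open import Level using (Level)
open import Data.Nat using (ℕ; _*_)
open import Data.Nat.Properties using (≤-refl; ≤-total)
open import Data.Bool using (Bool; true; false; if_then_else_; _∨_; _∧_)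
open import Data.Bool.Properties using (∨-assoc; ∨-commutativeMonoid)
open import Algebra.Bundles using (CommutativeMonoid)
open import Algebra.Properties.CommutativeSemigroup
  (CommutativeMonoid.commutativeSemigroup ∨-commutativeMonoid) using (x∙yz≈y∙xz)
open import Data.Fin using (Fin; zero; suc)
open import Data.Fin.Properties using (combine-injectiveˡ; combine-injectiveʳ) renaming (_≟_ to _≟F_)
open import Data.Fin.Permutation using (Permutation′; _⟨$⟩ˡ_; _∘ₚ_; transpose)
import Data.Fin.Permutation.Components as PC
open import Data.List using (List; []; _∷_; _++_; foldl)
open import Data.List.Membership.Propositional using (_∈_)
open import Data.List.Membership.Propositional.Properties using (∈-++⁺ʳ; ∈-∃++)
open import Data.List.Membership.Propositional.Properties.WithK using (unique∧set⇒bag)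
open import Data.List.Relation.Unary.Any using (here; there)
open import Data.List.Relation.Unary.All as All using (All; []; _∷_)
import Data.List.Relation.Unary.All.Properties as All
open import Data.List.Relation.Unary.AllPairs using (AllPairs; []; _∷_)
open import Data.List.Relation.Unary.Unique.Propositional using (Unique)
open import Data.List.Relation.Unary.Unique.Propositional.Properties using (Unique[x∷xs]⇒x∉xs)
open import Data.List.Relation.Binary.BagAndSetEquality using (∼bag⇒↭)
open import Data.List.Relation.Binary.Permutation.Propositional using (_↭_; ↭-sym)
open import Data.List.Relation.Binary.Permutation.Propositional.Properties
  using (↭-empty-inv; ∈-resp-↭; All-resp-↭; drop-mid)
open import Data.List.Properties using (∷-injective)
open import Data.Product using (_×_; _,_; proj₁; proj₂; uncurry)
open import Data.Product.Relation.Binary.Pointwise.NonDependent using (×-setoid)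
open import Data.Sum using (inj₁; inj₂)
open import Function.Bundles using (mk⇔)
open import Relation.Binary using (Rel; Setoid)
import Relation.Binary.Construct.On as On
import Relation.Binary.Reasoning.Setoid as SetoidReasoning
open import Relation.Nullary using (¬_; yes; no)
open import Relation.Nullary.Decidable using (dec-true; dec-false; toSum)
open import Relation.Binary.PropositionalEquality hiding (setoid)
open import Function using (_∘_)

private
  variable
    a r : Level
    A : Set a

module _ {R : Rel A r} where

  AllPairs-dropMid : ∀ xs {e ys} → AllPairs R (xs ++ e ∷ ys) → AllPairs R (xs ++ ys)
  AllPairs-dropMid []       (_ ∷ pys)  = pys
  AllPairs-dropMid (_ ∷ xs) (px ∷ pxs) =
    All.++⁺ (All.++⁻ˡ xs px) (All.tail (All.++⁻ʳ xs px)) ∷ AllPairs-dropMid xs pxs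

  AllPairs-beforeMid : ∀ xs {e ys} → AllPairs R (xs ++ e ∷ ys) → All (λ x → R x e) xs
  AllPairs-beforeMid []       _          = []
  AllPairs-beforeMid (_ ∷ xs) (px ∷ pxs) = All.head (All.++⁻ʳ xs px) ∷ AllPairs-beforeMid xs pxs

  AllPairs-fromSplits : ∀ {L} → (∀ pre {x rs y} → L ≡ pre ++ x ∷ rs → y ∈ rs → R x y) →
    AllPairs R L
  AllPairs-fromSplits {[]}    _ = []
  AllPairs-fromSplits {x ∷ L} R-split =
    All.tabulate (R-split [] refl) ∷
    AllPairs-fromSplits (λ pre eq → R-split (x ∷ pre) (cong (x ∷_) eq))

unique-split-precedes : ∀ pre as {x y : A} {rs bs} → Unique (pre ++ x ∷ rs) →
  pre ++ x ∷ rs ≡ as ++ y ∷ bs → y ∈ rs → ¬ x ∈ y ∷ bs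
unique-split-precedes [] [] u eq y∈rs _
  with refl , refl ← ∷-injective eq = Unique[x∷xs]⇒x∉xs u y∈rs
unique-split-precedes [] (_ ∷ as) u eq _ x∈y∷bs
  with refl , refl ← ∷-injective eq = Unique[x∷xs]⇒x∉xs u (∈-++⁺ʳ as x∈y∷bs)
unique-split-precedes (_ ∷ pre) [] u eq y∈rs _
  with refl , refl ← ∷-injective eq = Unique[x∷xs]⇒x∉xs u (∈-++⁺ʳ pre (there y∈rs))
unique-split-precedes (_ ∷ pre) (_ ∷ as) (_ ∷ u) eq =
  unique-split-precedes pre as u (proj₂ (∷-injective eq))

module _ {s ℓ : Level} (S : Setoid s ℓ) where

  open Setoid S using (_≈_) renaming (Carrier to State; refl to ≈-refl; sym to ≈-sym)

  module FoldLinearExtension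
    {a r : Level} {A : Set a}
    (step : State → A → State) (step-cong : ∀ {s t} e → s ≈ t → step s e ≈ step t e)
    (_≼_ : Rel A r)
    (step-comm : ∀ s {e e'} → ¬ e ≼ e' → ¬ e' ≼ e → step (step s e) e' ≈ step (step s e') e)
    where

    open SetoidReasoning S

    LinearExtension : List A → Set _
    LinearExtension = AllPairs (λ x y → ¬ y ≼ x)

    Incomparable : A → A → Set _
    Incomparable e x = ¬ e ≼ x × ¬ x ≼ e

    foldl-cong : ∀ {s t} L → s ≈ t → foldl step s L ≈ foldl step t L
    foldl-cong []      s≈t = s≈t
    foldl-cong (e ∷ L) s≈t = foldl-cong L (step-cong e s≈t)

    foldl-moveToFront : ∀ s xs {e} ys → All (Incomparable e) xs →
      foldl step s (xs ++ e ∷ ys) ≈ foldl step (step s e) (xs ++ ys)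
    foldl-moveToFront s []       ys []                       = ≈-refl
    foldl-moveToFront s (x ∷ xs) {e} ys ((e⋠x , x⋠e) ∷ inc) = begin
      foldl step (step s x) (xs ++ e ∷ ys)      ≈⟨ foldl-moveToFront (step s x) xs ys inc ⟩
      foldl step (step (step s x) e) (xs ++ ys) ≈⟨ foldl-cong (xs ++ ys) (step-comm s x⋠e e⋠x) ⟩
      foldl step (step (step s e) x) (xs ++ ys) ∎

    foldl-linearExtension-↭ : ∀ {L₁ L₂} → L₁ ↭ L₂ → LinearExtension L₁ → LinearExtension L₂ →
      ∀ s → foldl step s L₁ ≈ foldl step s L₂
    foldl-linearExtension-↭ {[]} p _ _ s rewrite ↭-empty-inv (↭-sym p) = ≈-refl
    foldl-linearExtension-↭ {e ∷ L₁} p (L₁⋠e ∷ ext₁) ext₂ s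
      with xs , ys , refl ← ∈-∃++ (∈-resp-↭ p (here refl)) = begin
        foldl step (step s e) L₁         ≈⟨ foldl-linearExtension-↭ L₁↭ ext₁ (AllPairs-dropMid xs ext₂) _ ⟩
        foldl step (step s e) (xs ++ ys) ≈⟨ ≈-sym (foldl-moveToFront s xs ys incomparable) ⟩
        foldl step s (xs ++ e ∷ ys)      ∎
      where
      L₁↭ : L₁ ↭ xs ++ ys
      L₁↭ = drop-mid [] xs p
      incomparable : All (Incomparable e) xs
      incomparable = All.zip (AllPairs-beforeMid xs ext₂ , All.++⁻ˡ xs (All-resp-↭ L₁↭ L₁⋠e))

module _ {m : ℕ} where

  transpose-matchˡ : (i j : Fin m) → PC.transpose i j i ≡ j
  transpose-matchˡ i j rewrite dec-true (i ≟F i) refl = refl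

  transpose-matchʳ : (i j : Fin m) → PC.transpose i j j ≡ i
  transpose-matchʳ i j with j ≟F i
  ... | yes refl = refl
  ... | no _ rewrite dec-true (j ≟F j) refl = refl

  transpose-other : {i j k : Fin m} → k ≢ i → k ≢ j → PC.transpose i j k ≡ k
  transpose-other {i} {j} {k} k≢i k≢j rewrite dec-false (k ≟F i) k≢i | dec-false (k ≟F j) k≢j = refl

  transpose-comm : {i j k l : Fin m} → i ≢ k → i ≢ l → j ≢ k → j ≢ l → ∀ x →
    PC.transpose i j (PC.transpose k l x) ≡ PC.transpose k l (PC.transpose i j x)
  transpose-comm {i} {j} {k} {l} i≢k i≢l j≢k j≢l x
    with toSum (x ≟F i) | toSum (x ≟F j) | toSum (x ≟F k) | toSum (x ≟F l)
  ... | inj₁ refl | _ | _ | _ rewrite transpose-other i≢k i≢l | transpose-matchˡ x j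
    = sym (transpose-other j≢k j≢l)
  ... | inj₂ _ | inj₁ refl | _ | _ rewrite transpose-other j≢k j≢l | transpose-matchʳ i x
    = sym (transpose-other i≢k i≢l)
  ... | inj₂ x≢i | inj₂ x≢j | inj₁ refl | _ rewrite transpose-other x≢i x≢j | transpose-matchˡ x l
    = transpose-other (i≢l ∘ sym) (j≢l ∘ sym)
  ... | inj₂ x≢i | inj₂ x≢j | inj₂ _ | inj₁ refl rewrite transpose-other x≢i x≢j | transpose-matchʳ k x
    = transpose-other (i≢k ∘ sym) (j≢k ∘ sym)
  ... | inj₂ x≢i | inj₂ x≢j | inj₂ x≢k | inj₂ x≢l
    rewrite transpose-other x≢k x≢l | transpose-other x≢i x≢j | transpose-other x≢k x≢l = refl

  edgeConfig-cong : {σ τ : Permutation′ m} {i j : Fin m} →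
    σ ⟨$⟩ˡ i ≡ τ ⟨$⟩ˡ i → σ ⟨$⟩ˡ j ≡ τ ⟨$⟩ˡ j → edgeConfig σ i j ≡ edgeConfig τ i j
  edgeConfig-cong p q rewrite p | q = refl

module _ {n : ℕ} where

  State : Set
  State = Perm n × Graph n

  -- A state is observed through σ⁻¹, which is all that step reads of σ.
  stateSetoid : Setoid _ _
  stateSetoid =
    On.setoid (×-setoid (Fin (n * 2) →-setoid Fin (n * 2)) (Pair n →-setoid Bool)) observe
    where
    observe : State → (Fin (n * 2) → Fin (n * 2)) × (Pair n → Bool)
    observe (σ , g) = (σ ⟨$⟩ˡ_) , uncurry g

  open Setoid stateSetoid using (_≈_)

  -- step s (u , v) is definitionally fire (edgeConfig σ (even′ u) (odd′ v)) s (u , v).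
  fire : Bool → State → Pair n → State
  fire b (σ , g) (u , v) = if b then (σ ∘ₚ transpose (even′ u) (odd′ v) , addEdge g u v) else (σ , g)

  addEdge-cong : ∀ {g h : Graph n} u v x y → g x y ≡ h x y → addEdge g u v x y ≡ addEdge h u v x y
  addEdge-cong u v x y = cong (λ z → (finEq x u ∧ finEq y v) ∨ (finEq x v ∧ finEq y u) ∨ z)

  addEdge-comm : ∀ (g : Graph n) u v u' v' x y →
    addEdge (addEdge g u v) u' v' x y ≡ addEdge (addEdge g u' v') u v x y
  addEdge-comm g u v u' v' x y = begin
    P' ∨ Q' ∨ P ∨ Q ∨ g x y     ≡⟨ sym (∨-assoc P' Q' _) ⟩
    (P' ∨ Q') ∨ P ∨ Q ∨ g x y   ≡⟨ cong ((P' ∨ Q') ∨_) (sym (∨-assoc P Q _)) ⟩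
    (P' ∨ Q') ∨ (P ∨ Q) ∨ g x y ≡⟨ x∙yz≈y∙xz (P' ∨ Q') (P ∨ Q) (g x y) ⟩
    (P ∨ Q) ∨ (P' ∨ Q') ∨ g x y ≡⟨ cong ((P ∨ Q) ∨_) (∨-assoc P' Q' _) ⟩
    (P ∨ Q) ∨ P' ∨ Q' ∨ g x y   ≡⟨ ∨-assoc P Q _ ⟩
    P ∨ Q ∨ P' ∨ Q' ∨ g x y     ∎
    where
    open ≡-Reasoning
    P = finEq x u ∧ finEq y v
    Q = finEq x v ∧ finEq y u
    P' = finEq x u' ∧ finEq y v'
    Q' = finEq x v' ∧ finEq y u'

  fire-cong : ∀ b {s t} e → s ≈ t → fire b s e ≈ fire b t e
  fire-cong true {_ , g} {_ , h} (u , v) (σ≈τ , g≈h) =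
    (λ _ → σ≈τ _) , λ (x , y) → addEdge-cong {g = g} {h} u v x y (g≈h (x , y))
  fire-cong false _ s≈t = s≈t

  step-cong : ∀ {s t} e → s ≈ t → step s e ≈ step t e
  step-cong {σ , _} {τ , _} (u , v) s≈t@(σ≈τ , _)
    rewrite edgeConfig-cong {σ = σ} {τ} {even′ u} {odd′ v} (σ≈τ _) (σ≈τ _) =
    fire-cong (edgeConfig τ (even′ u) (odd′ v)) (u , v) s≈t

  Independent : Pair n → Pair n → Set
  Independent (u , v) (u' , v') = u ≢ u' × v ≢ v'

  Independent-sym : ∀ {e e'} → Independent e e' → Independent e' e
  Independent-sym (u≢u' , v≢v') = u≢u' ∘ sym , v≢v' ∘ sym

  even′≢odd′ : (u v : Fin n) → even′ u ≢ odd′ v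
  even′≢odd′ u v eq with () ← combine-injectiveʳ u (suc zero) v zero eq

  even′-injective : {u u' : Fin n} → even′ u ≡ even′ u' → u ≡ u'
  even′-injective {u} {u'} = combine-injectiveˡ u (suc zero) u' (suc zero)

  odd′-injective : {v v' : Fin n} → odd′ v ≡ odd′ v' → v ≡ v'
  odd′-injective {v} {v'} = combine-injectiveˡ v zero v' zero

  edgeConfig-fire : ∀ {u v u' v'} → Independent (u , v) (u' , v') → ∀ b s →
    edgeConfig (proj₁ (fire b s (u , v))) (even′ u') (odd′ v')
      ≡ edgeConfig (proj₁ s) (even′ u') (odd′ v')
  edgeConfig-fire {u} {v} {u'} {v'} (u≢u' , v≢v') true (σ , _) =
    edgeConfig-cong {σ = σ ∘ₚ transpose (even′ u) (odd′ v)} {σ}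
    (cong (σ ⟨$⟩ˡ_) (transpose-other (even′≢odd′ u' v) (u≢u' ∘ sym ∘ even′-injective)))
    (cong (σ ⟨$⟩ˡ_) (transpose-other (v≢v' ∘ sym ∘ odd′-injective) (even′≢odd′ u v' ∘ sym)))
  edgeConfig-fire _ false _ = refl

  fire-comm : ∀ {e e'} → Independent e e' → ∀ b b' s →
    fire b' (fire b s e) e' ≈ fire b (fire b' s e') e
  fire-comm {u , v} {u' , v'} (u≢u' , v≢v') true true (σ , g) =
    (λ x → cong (σ ⟨$⟩ˡ_) (transpose-comm (v≢v' ∘ odd′-injective) (even′≢odd′ u' v ∘ sym)
                                          (even′≢odd′ u v') (u≢u' ∘ even′-injective) x)) ,
    λ (x , y) → addEdge-comm g u v u' v' x y
  fire-comm _ true  false _ = (λ _ → refl) , (λ _ → refl)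
  fire-comm _ false true  _ = (λ _ → refl) , (λ _ → refl)
  fire-comm _ false false _ = (λ _ → refl) , (λ _ → refl)

  step-comm : ∀ s {e e'} → Independent e e' → step (step s e) e' ≈ step (step s e') e
  step-comm s@(σ , _) {e@(u , v)} {e'@(u' , v')} ind = begin
    step (step s e) e'      ≡⟨ cong (λ c → fire c (step s e) e') (edgeConfig-fire ind b s) ⟩
    fire b' (fire b s e) e' ≈⟨ fire-comm ind b b' s ⟩
    fire b (fire b' s e') e ≡⟨ cong (λ c → fire c (step s e') e)
                                    (sym (edgeConfig-fire (Independent-sym ind) b' s)) ⟩
    step (step s e') e      ∎
    where
    open SetoidReasoning stateSetoid
    b = edgeConfig σ (even′ u) (odd′ v)
    b' = edgeConfig σ (even′ u') (odd′ v')

  incomparable⇒independent : ∀ {e e'} → ¬ e ⪯ e' → ¬ e' ⪯ e → Independent e e'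
  incomparable⇒independent {u , v} {u' , v'} e⋠e' e'⋠e = u≢u' , v≢v'
    where
    u≢u' : u ≢ u'
    u≢u' refl with ≤-total (lab v) (lab v')
    ... | inj₁ v≤v' = e⋠e' (≤-refl , v≤v')
    ... | inj₂ v'≤v = e'⋠e (≤-refl , v'≤v)
    v≢v' : v ≢ v'
    v≢v' refl with ≤-total (lab u') (lab u)
    ... | inj₁ u'≤u = e⋠e' (u'≤u , ≤-refl)
    ... | inj₂ u≤u' = e'⋠e (u≤u' , ≤-refl)

  step-comm-incomparable : ∀ s {e e'} → ¬ e ⪯ e' → ¬ e' ⪯ e →
    step (step s e) e' ≈ step (step s e') e
  step-comm-incomparable s e⋠e' e'⋠e = step-comm s (incomparable⇒independent e⋠e' e'⋠e)

  validOrder⇒linearExtension : ∀ {L} → ValidOrder n L → AllPairs (λ e e' → ¬ e' ⪯ e) L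
  validOrder⇒linearExtension {L} (isPairs , unique , _ , ⪯⇒≤) = AllPairs-fromSplits precedes
    where
    precedes : ∀ pre {x rs y} → L ≡ pre ++ x ∷ rs → y ∈ rs → ¬ y ⪯ x
    precedes pre refl y∈rs y⪯x
      with as , bs , L≡ , x∈ ← ⪯⇒≤ _ _ (All.lookup isPairs (∈-++⁺ʳ pre (there y∈rs)))
                                      (All.lookup isPairs (∈-++⁺ʳ pre (here refl))) y⪯x
      = unique-split-precedes pre as unique L≡ y∈rs x∈

  validOrders-↭ : ∀ {L₁ L₂} → ValidOrder n L₁ → ValidOrder n L₂ → L₁ ↭ L₂
  validOrders-↭ (isPairs₁ , unique₁ , complete₁ , _) (isPairs₂ , unique₂ , complete₂ , _) =
    ∼bag⇒↭ (unique∧set⇒bag unique₁ unique₂ (mk⇔ (λ e∈ → complete₂ _ (All.lookup isPairs₁ e∈))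
                                                 (λ e∈ → complete₁ _ (All.lookup isPairs₂ e∈))))

mainTheorem4 : (n : ℕ) (π : Perm n) → InD n π →
    (L₁ L₂ : List (Pair n)) → ValidOrder n L₁ → ValidOrder n L₂ →
    (u v : Fin n) → Γ L₁ π u v ≡ Γ L₂ π u v
mainTheorem4 n π _ L₁ L₂ valid₁ valid₂ u v =
  proj₂ (foldl-linearExtension-↭ (validOrders-↭ valid₁ valid₂)
          (validOrder⇒linearExtension valid₁) (validOrder⇒linearExtension valid₂) (π , edgeless)) (u , v)
  where
  open FoldLinearExtension stateSetoid step step-cong _⪯_ step-comm-incomparable
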